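{- Let $b$ be a prime and $m\ge1$ an integer. Let $F_1\in\mathbb{F}_b^{m\times m}$ be the identity matrix and $F_2\in\mathbb{F}_b^{m\times m}$ the matrix with $(F_2)_{k,\ell}=1$ if $k+\ell\le m+1$ and $(F_2)_{k,\ell}=0$ otherwise (the Larcher--Pillichshammer net). Then for any $\boldsymbol{\delta}\in\{0,1/b^m,2/b^m,\ldots,(b^m-1)/b^m\}^2$, the digitally shifted digital net $Q(F_1,F_2)\oplus\boldsymbol{\delta}$ is $(\lceil m/2\rceil+1)$-separated in base $b$ and also toroidally $(\lceil m/2\rceil+1)$-separated in base $b$.
   Context: Digital net over $\mathbb{F}_b$: for $n\in\{0,\ldots,b^m-1\}$ with digits $n=n_0+n_1b+\cdots+n_{m-1}b^{m-1}$, $\vec n=(n_0,\ldots,n_{m-1})^\top$, $\vec x_{n,j}=F_j\vec n=(x_{n,j,1},\ldots,x_{n,j,m})^\top$, $x_{n,j}=\sum_{k=1}^m x_{n,j,k}b^{ -k}$; $Q(F_1,F_2)=\{\boldsymbol{x}_0,\ldots,\boldsymbol{x}_{b^m-1}\}$. Digital shift: with $\delta_j=\sum_{k=1}^m\delta_{j,k}b^{ -k}$, $x_{n,j}\oplus\delta_j=\sum_{k=1}^m((x_{n,j,k}+\delta_{j,k})\bmod b)b^{ -k}$. Shifted $b$-adic elementary interval: $J_{\boldsymbol{c},\boldsymbol{a},\boldsymbol{e}}=\prod_{j}\left[\frac{a_j-e_j/b}{b^{c_j}},\frac{a_j+(b-e_j)/b}{b^{c_j}}\right)$ for integers $c_j\ge0$,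 $0\le a_j\le b^{c_j}$, $e_j\in\{0,\ldots,b-1\}$; toroidal version $\tilde J_{\boldsymbol{c},\boldsymbol{a},\boldsymbol{e}}=\prod_j\left(\left[\frac{a_j-e_j/b}{b^{c_j}},\frac{a_j+(b-e_j)/b}{b^{c_j}}\right)\bmod1\right)$ for $0\le a_j<b^{c_j}$, where $A\bmod1=\{x\in[0,1)\mid\exists z\in\mathbb{Z}:x+z\in A\}$. A finite $P\subset[0,1)^d$ is $\kappa$-separated in base $b$ if there is $\boldsymbol{c}$ with $0\le c_j\le\kappa$ such that every $J_{\boldsymbol{c},\boldsymbol{a},\boldsymbol{e}}\subseteq[0,1)^d$ contains at most one point of $P$; toroidally $\kappa$-separated likewise with all $\tilde J_{\boldsymbol{c},\boldsymbol{a},\boldsymbol{e}}$. -}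

module Defs where

open import Data.Nat using (ℕ; zero; suc; _+_; _*_; _∸_; _^_; _≤_; _<_; _%_; _/_; NonZero)
open import Data.Nat.Properties using (m^n≢0)
open import Data.Fin using (Fin; toℕ; zero; suc)
open import Data.Integer as ℤ using (ℤ; +_)
open import Data.Product using (Σ; ∃; _×_)
open import Data.Bool using (if_then_else_)
open import Relation.Binary.PropositionalEquality using (_≡_)
open import Relation.Nullary.Decidable using (does)
open import Data.Nat using (_<?_; _≟_)

Σfin : (n : ℕ) → (Fin n → ℕ) → ℕ
Σfin zero    f = 0
Σfin (suc n) f = f zero + Σfin n (λ i → f (suc i))

digit : (b i n : ℕ) → ℕ
digit zero    i n = 0
digit (suc k) i n = _%_ (_/_ n (suc k ^ i) {{m^n≢0 (suc k) i}}) (suc k)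

-- x mod b (b = 0 never occurs since b is prime; there it is the identity).
modb : ℕ → ℕ → ℕ
modb zero    x = x
modb (suc k) x = x % suc k

-- m×m matrices over F_b, entries represented by naturals (read mod b).
Mat : ℕ → Set
Mat m = Fin m → Fin m → ℕ

idMat : (m : ℕ) → Mat m
idMat m k l = if does (toℕ k ≟ toℕ l) then 1 else 0

-- Larcher–Pillichshammer matrix: (F_2)_{k,l} = 1 iff k + l ≤ m + 1 (1-based),
-- i.e. toℕ k + toℕ l < m with 0-based indices.
lpMat : (m : ℕ) → Mat m
lpMat m k l = if does ((toℕ k + toℕ l) <? m) then 1 else 0

-- k-th digit (0-based k, i.e. x_{n,j,k+1}) of the point coordinate F n over F_b.
netDigit : (b m : ℕ) → Mat m → ℕ → Fin m → ℕ
netDigit b m F n k = modb b (Σfin m (λ l → F k l * digit b (toℕ l) n))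

-- Numerator (over b^m) of x_{n,j} ⊕ δ_j, where δ_j = D / b^m with D < b^m;
-- δ_{j,k+1} is the base-b digit of D at position m-1-k.
shiftedNum : (b m : ℕ) → Mat m → (D n : ℕ) → ℕ
shiftedNum b m F D n =
  Σfin m (λ k → modb b (netDigit b m F n k + digit b (m ∸ suc (toℕ k)) D) * b ^ (m ∸ suc (toℕ k)))

-- Membership of the point X / b^m in
-- [ (a - e/b)/b^c , (a + (b-e)/b)/b^c ) = [ (ab - e)/b^{c+1} , (ab + b - e)/b^{c+1} ),
-- cross-multiplied by b^{m+c+1} in ℤ.
inInt : (b m c a e : ℕ) → ℤ → Set
inInt b m c a e X =
  ((+ (a * b) ℤ.- + e) ℤ.* + (b ^ m) ℤ.≤ X ℤ.* + (b ^ suc c))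
  × (X ℤ.* + (b ^ suc c) ℤ.< (+ (a * b + b) ℤ.- + e) ℤ.* + (b ^ m))

-- Membership of X / b^m in ([l, r) mod 1): ∃ z ∈ ℤ, X / b^m + z ∈ [l, r).
inTor : (b m c a e : ℕ) → ℤ → Set
inTor b m c a e X = ∃ λ (z : ℤ) → inInt b m c a e (X ℤ.+ z ℤ.* + (b ^ m))

-- The one-dimensional interval [ (ab - e)/b^{c+1}, (ab + b - e)/b^{c+1} ) is contained in [0,1):
-- left endpoint ≥ 0 and right endpoint ≤ 1.
inUnit : (b c a e : ℕ) → Set
inUnit b c a e = (+ e ℤ.≤ + (a * b)) × (+ (a * b + b) ℤ.- + e ℤ.≤ + (b ^ suc c))

-- A finite point set P = { p i | i < N } ⊂ [0,1)^d whose coordinates are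
-- p i j / b^m (with p i j < b^m).
-- κ-separated in base b: there is c with c_j ≤ κ such that every J_{c,a,e} ⊆ [0,1)^d
-- (0 ≤ a_j ≤ b^{c_j}, e_j < b) contains at most one point of P.
Separated : (b m d N : ℕ) → (ℕ → Fin d → ℕ) → ℕ → Set
Separated b m d N p κ =
  Σ (Fin d → ℕ) λ c → (∀ j → c j ≤ κ) ×
    ((a e : Fin d → ℕ) → (∀ j → a j ≤ b ^ c j) → (∀ j → e j < b) →
     (∀ j → inUnit b (c j) (a j) (e j)) →
     (i i' : ℕ) → i < N → i' < N →
     (∀ j → inInt b m (c j) (a j) (e j) (+ p i j)) →
     (∀ j → inInt b m (c j) (a j) (e j) (+ p i' j)) →
     ∀ j → p i j ≡ p i' j)

TorSeparated : (b m d N : ℕ) → (ℕ → Fin d → ℕ) → ℕ → Set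
TorSeparated b m d N p κ =
  Σ (Fin d → ℕ) λ c → (∀ j → c j ≤ κ) ×
    ((a e : Fin d → ℕ) → (∀ j → a j < b ^ c j) → (∀ j → e j < b) →
     (i i' : ℕ) → i < N → i' < N →
     (∀ j → inTor b m (c j) (a j) (e j) (+ p i j)) →
     (∀ j → inTor b m (c j) (a j) (e j) (+ p i' j)) →
     ∀ j → p i j ≡ p i' j)

-- The digitally shifted digital net Q(F_1,F_2) ⊕ (D_1/b^m, D_2/b^m) in dimension 2,
-- point n given by its numerators over b^m.
shiftedNet2 : (b m : ℕ) → Mat m → Mat m → ℕ → ℕ → ℕ → Fin 2 → ℕ
shiftedNet2 b m F₁ F₂ D₁ D₂ n zero = shiftedNum b m F₁ D₁ n
shiftedNet2 b m F₁ F₂ D₁ D₂ n (suc zero) = shiftedNum b m F₂ D₂ n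

{-# OPTIONS --safe #-}

-- Primality of b is used only through b ≥ 2. If two points lie in a common (toroidal) interval
-- of side b^-κ, the integers formed by the first κ+1 digits of their coordinates (integer part
-- included) differ by less than b. Hence, modulo b, the digit differences of each coordinate read
-- 0 … 0 s … s t with s, t ≢ 0: a single carry. The shift cancels modulo b, so with vₗ = nₗ − n'ₗ
-- the first coordinate sees v₀ … v_κ and the second sees the partial sums T(m−k) = Σ_{l<m−k} vₗ
-- for k ≤ κ. Since 2κ ≥ m + 2 the two views overlap: a carry starting in v at position κ−1 would
-- force T(κ) ≡ T(κ+1) ≡ 0 through the second coordinate, i.e. v_κ ≡ 0, contradicting the carry
-- shape. So v₀ … v_{κ−1} ≡ 0, hence T(0) … T(κ) ≡ 0, and the second coordinate extends this to
-- all T(j), j ≤ m; thus every vₗ ≡ 0 and the points coincide. (For m ≤ κ the zero padding at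
-- position m already forces every vₗ ≡ 0.)
module Submission where

open import Data.Nat
  using (ℕ; zero; suc; z≤n; s≤s; _+_; _*_; _∸_; _^_; _≤_; _<_; _%_; _/_; _⊓_; ⌈_/2⌉; _≟_; _<?_; _≤?_)
import Data.Nat.Properties as ℕₚ
open import Data.Nat.Divisibility using (>⇒∤) renaming (_∣_ to _∣ℕ_)
open import Data.Nat.DivMod using (m≡m%n+[m/n]*n; m%n<n)
open import Data.Nat.Primality using (Prime; ¬prime[0]; ¬prime[1])
open import Data.Integer as ℤ using (ℤ; +_; -_; _-_)
import Data.Integer.Properties as ℤₚ
open import Data.Integer.Divisibility.Signed
  using (_∣_; _∣?_; divides; ∣⇒∣ᵤ; ∣m∣n⇒∣m+n; ∣m∣n⇒∣m-n; ∣m⇒∣-m; ∣m+n∣m⇒∣n; ∣m+n∣n⇒∣m)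
open import Data.Integer.Tactic.RingSolver using (solve-∀)
open import Data.Nat.Tactic.RingSolver renaming (solve-∀ to ℕ-solve-∀) using ()
open import Data.Fin as Fin using (Fin; toℕ)
open import Data.Fin.Properties using (toℕ<n)
open import Data.Bool using (if_then_else_)
open import Data.Product using (_×_; _,_; proj₁; proj₂)
open import Data.Sum using (inj₁; inj₂)
open import Data.Empty using (⊥-elim)
open import Function using (_∘_)
open import Relation.Nullary using (¬_; yes; no; contradiction)
open import Relation.Nullary.Decidable using (does; dec-true; dec-false)
open import Relation.Binary.PropositionalEquality
open import Defs

downwardInduction : ∀ {p} (P : ℕ → Set p) {n : ℕ} → P n →
                    (∀ {i} → i < n → P (suc i) → P i) → ∀ {i} → i ≤ n → P i
downwardInduction P {n} Pn step {i} i≤n = go (n ∸ i) i (ℕₚ.m∸n+n≡m i≤n)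
  where
  go : ∀ j i → j + i ≡ n → P i
  go zero    i refl = Pn
  go (suc j) i refl = step (ℕₚ.m<n+m i (s≤s z≤n)) (go j (suc i) (ℕₚ.+-suc j i))

quotient-lowerBound : ∀ (B : ℕ) {L q : ℤ} {r : ℕ} → r < B →
                      L ℤ.* + B ℤ.≤ q ℤ.* + B ℤ.+ + r → L ℤ.≤ q
quotient-lowerBound B {L} {q} {r} r<B LB≤qB+r with L ℤₚ.≤? q
... | yes L≤q = L≤q
... | no  L≰q = contradiction qB+r<qB+r (ℤₚ.<-irrefl refl)
  where
  open ℤₚ.≤-Reasoning
  qB+B≡[1+q]B : ∀ q B → q ℤ.* B ℤ.+ B ≡ (+ 1 ℤ.+ q) ℤ.* B
  qB+B≡[1+q]B = solve-∀
  qB+r<qB+r : q ℤ.* + B ℤ.+ + r ℤ.< q ℤ.* + B ℤ.+ + r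
  qB+r<qB+r = begin-strict
    q ℤ.* + B ℤ.+ + r  <⟨ ℤₚ.+-monoʳ-< (q ℤ.* + B) (ℤ.+<+ r<B) ⟩
    q ℤ.* + B ℤ.+ + B  ≡⟨ qB+B≡[1+q]B q (+ B) ⟩
    ℤ.suc q ℤ.* + B    ≤⟨ ℤₚ.*-monoʳ-≤-nonNeg (+ B) (ℤₚ.i<j⇒suc[i]≤j (ℤₚ.≰⇒> L≰q)) ⟩
    L ℤ.* + B          ≤⟨ LB≤qB+r ⟩
    q ℤ.* + B ℤ.+ + r  ∎

quotient-upperBound : ∀ (B : ℕ) {L q : ℤ} {r : ℕ} →
                      q ℤ.* + B ℤ.+ + r ℤ.< L ℤ.* + B → q ℤ.< L
quotient-upperBound B {r = r} qB+r<LB =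
  ℤₚ.*-cancelʳ-<-nonNeg (+ B) (ℤₚ.≤-<-trans (ℤₚ.i≤i+j _ (+ r)) qB+r<LB)

∣-m⇒∣m : ∀ {i m} → i ∣ - m → i ∣ m
∣-m⇒∣m {m = m} i∣-m = subst (_ ∣_) (ℤₚ.neg-involutive m) (∣m⇒∣-m i∣-m)

∣m-n∣m⇒∣n : ∀ {i m n} → i ∣ m - n → i ∣ m → i ∣ n
∣m-n∣m⇒∣n i∣m-n i∣m = ∣-m⇒∣m (∣m+n∣m⇒∣n i∣m-n i∣m)

∣m-n∣n⇒∣m : ∀ {i m n} → i ∣ m - n → i ∣ n → i ∣ m
∣m-n∣n⇒∣m i∣m-n i∣n = ∣m+n∣n⇒∣m i∣m-n (∣m⇒∣-m i∣n)

pos-*+ : ∀ e f x → + (e * f + x) ≡ + e ℤ.* + f ℤ.+ + x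
pos-*+ e f x = trans (ℤₚ.pos-+ (e * f) x) (cong (ℤ._+ + x) (ℤₚ.pos-* e f))

Σfin-cong : ∀ N {f g : Fin N → ℕ} → (∀ i → f i ≡ g i) → Σfin N f ≡ Σfin N g
Σfin-cong zero    eq = refl
Σfin-cong (suc N) eq = cong₂ _+_ (eq Fin.zero) (Σfin-cong N (eq ∘ Fin.suc))

Σfin-snoc : ∀ N (f : ℕ → ℕ) → Σfin (suc N) (f ∘ toℕ) ≡ Σfin N (f ∘ toℕ) + f N
Σfin-snoc zero    f = ℕₚ.+-identityʳ (f 0)
Σfin-snoc (suc N) f = trans (cong (_+_ (f 0)) (Σfin-snoc N (f ∘ suc))) (sym (ℕₚ.+-assoc (f 0) _ _))

identity : ℕ → ℕ → ℕ
identity k l = if does (k ≟ l) then 1 else 0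

larcherPillichshammer : ℕ → ℕ → ℕ → ℕ
larcherPillichshammer m k l = if does (k + l <? m) then 1 else 0

partialSum : (ℕ → ℕ) → ℕ → ℕ
partialSum h j = Σfin j (h ∘ toℕ)

Σfin-identity : ∀ N (h : ℕ → ℕ) {k} → k < N → Σfin N (λ l → identity k (toℕ l) * h (toℕ l)) ≡ h k
Σfin-identity (suc N) h {zero}  _ =
  trans (cong₂ _+_ (ℕₚ.+-identityʳ (h 0)) (Σfin-zero N)) (ℕₚ.+-identityʳ (h 0))
  where
  Σfin-zero : ∀ N → Σfin N (λ _ → 0) ≡ 0
  Σfin-zero zero    = refl
  Σfin-zero (suc N) = Σfin-zero N
Σfin-identity (suc N) h {suc k} (s≤s k<N) = Σfin-identity N (h ∘ suc) k<N

Σfin-larcherPillichshammer : ∀ m k (h : ℕ → ℕ) → k ≤ m →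
  Σfin m (λ l → larcherPillichshammer m k (toℕ l) * h (toℕ l)) ≡ partialSum h (m ∸ k)
Σfin-larcherPillichshammer m k h k≤m =
  trans (truncated m) (cong (partialSum h) (ℕₚ.m≥n⇒m⊓n≡n (ℕₚ.m∸n≤m m k)))
  where
  f : ℕ → ℕ
  f l = larcherPillichshammer m k l * h l
  below : ∀ {N} → k + N < m → suc N ≤ m ∸ k
  below {N} k+N<m = ℕₚ.m+n≤o⇒m≤o∸n (suc N) (subst (_≤ m) (cong suc (ℕₚ.+-comm k N)) k+N<m)
  above : ∀ {N} → ¬ (k + N < m) → m ∸ k ≤ N
  above k+N≮m = ℕₚ.m≤n+o⇒m∸n≤o _ k (ℕₚ.≮⇒≥ k+N≮m)
  step : ∀ N → partialSum h (N ⊓ (m ∸ k)) + f N ≡ partialSum h (suc N ⊓ (m ∸ k))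
  step N with k + N <? m
  ... | yes k+N<m
    rewrite dec-true (k + N <? m) k+N<m
          | ℕₚ.m≤n⇒m⊓n≡m (ℕₚ.<⇒≤ (below k+N<m)) | ℕₚ.m≤n⇒m⊓n≡m (below k+N<m) =
    trans (cong (_+_ (partialSum h N)) (ℕₚ.+-identityʳ (h N))) (sym (Σfin-snoc N h))
  ... | no  k+N≮m
    rewrite dec-false (k + N <? m) k+N≮m
          | ℕₚ.m≥n⇒m⊓n≡n (above k+N≮m) | ℕₚ.m≥n⇒m⊓n≡n (ℕₚ.m≤n⇒m≤1+n (above k+N≮m)) =
    ℕₚ.+-identityʳ _
  truncated : ∀ N → Σfin N (f ∘ toℕ) ≡ partialSum h (N ⊓ (m ∸ k))
  truncated zero    = refl
  truncated (suc N) = trans (Σfin-snoc N f) (trans (cong (_+ f N) (truncated N)) (step N))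

inInt⇒inTor : ∀ b m c a e X → inInt b m c a e X → inTor b m c a e X
inInt⇒inTor b m c a e X J∋X = + 0 , subst (inInt b m c a e) (sym (ℤₚ.+-identityʳ X)) J∋X

shiftedNum-cong : ∀ {b m} F D {n n'} → (∀ l → l < m → digit b l n ≡ digit b l n') →
                  shiftedNum b m F D n ≡ shiftedNum b m F D n'
shiftedNum-cong {b} {m} F D same = Σfin-cong m (λ k →
  cong (λ s → modb b (modb b s + digit b (m ∸ suc (toℕ k)) D) * b ^ (m ∸ suc (toℕ k)))
       (Σfin-cong m (λ l → cong (F k l *_) (same (toℕ l) (toℕ<n l)))))

module InBase (b-2 : ℕ) where

  b : ℕ
  b = 2 + b-2

  Digits : (ℕ → ℕ) → Set
  Digits x = ∀ i → x i < b

  value : ℕ → (ℕ → ℕ) → ℕ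
  value n x = Σfin n (λ i → x (toℕ i) * b ^ (n ∸ suc (toℕ i)))

  value-cong : ∀ n {x y} → (∀ i → i < n → x i ≡ y i) → value n x ≡ value n y
  value-cong zero    eq = refl
  value-cong (suc n) eq =
    cong₂ _+_ (cong (_* b ^ n) (eq 0 (s≤s z≤n))) (value-cong n (λ i i<n → eq (suc i) (s≤s i<n)))

  value-vanishes : ∀ n {x} → (∀ i → i < n → x i ≡ 0) → value n x ≡ 0
  value-vanishes n {x} x≡0 = trans (value-cong n {x} {λ _ → 0} x≡0) (zeros n)
    where
    zeros : ∀ n → value n (λ _ → 0) ≡ 0
    zeros zero    = refl
    zeros (suc n) = zeros n

  value-snoc : ∀ n x → value (suc n) x ≡ value n x * b + x n
  value-snoc zero    x = trans (ℕₚ.+-identityʳ _) (ℕₚ.*-identityʳ _)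
  value-snoc (suc n) x = begin
    x 0 * b ^ suc n + value (suc n) (x ∘ suc)
      ≡⟨ cong (_+_ (x 0 * b ^ suc n)) (value-snoc n (x ∘ suc)) ⟩
    x 0 * (b * b ^ n) + (value n (x ∘ suc) * b + x (suc n))
      ≡⟨ horner (x 0) (b ^ n) (value n (x ∘ suc)) (x (suc n)) b ⟩
    (x 0 * b ^ n + value n (x ∘ suc)) * b + x (suc n) ∎
    where
    open ≡-Reasoning
    horner : ∀ a p v w B → a * (B * p) + (v * B + w) ≡ (a * p + v) * B + w
    horner = ℕ-solve-∀

  value-++ : ∀ i j x → value (i + j) x ≡ value i x * b ^ j + value j (x ∘ (_+_ i))
  value-++ zero    j x = refl
  value-++ (suc i) j x = begin
    x 0 * b ^ (i + j) + value (i + j) (x ∘ suc)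
      ≡⟨ cong₂ (λ p v → x 0 * p + v) (ℕₚ.^-distribˡ-+-* b i j) (value-++ i j (x ∘ suc)) ⟩
    x 0 * (b ^ i * b ^ j) + (value i (x ∘ suc) * b ^ j + value j (x ∘ suc ∘ (_+_ i)))
      ≡⟨ distrib (x 0) (b ^ i) (b ^ j) (value i (x ∘ suc)) _ ⟩
    (x 0 * b ^ i + value i (x ∘ suc)) * b ^ j + value j (x ∘ suc ∘ (_+_ i)) ∎
    where
    open ≡-Reasoning
    distrib : ∀ a p q v w → a * (p * q) + (v * q + w) ≡ (a * p + v) * q + w
    distrib = ℕ-solve-∀

  value<b^ : ∀ n {x} → Digits x → value n x < b ^ n
  value<b^ zero    _   = s≤s z≤n
  value<b^ (suc n) {x} x<b = begin-strict
    x 0 * b ^ n + value n (x ∘ suc) <⟨ ℕₚ.+-monoʳ-< (x 0 * b ^ n) (value<b^ n (x<b ∘ suc)) ⟩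
    x 0 * b ^ n + b ^ n             ≡⟨ ℕₚ.+-comm (x 0 * b ^ n) (b ^ n) ⟩
    suc (x 0) * b ^ n               ≤⟨ ℕₚ.*-monoˡ-≤ (b ^ n) (x<b 0) ⟩
    b * b ^ n                       ∎
    where open ℕₚ.≤-Reasoning

  +value-snoc : ∀ p x → + value (suc p) x ≡ + value p x ℤ.* + b ℤ.+ + x p
  +value-snoc p x = trans (cong +_ (value-snoc p x)) (pos-*+ (value p x) b (x p))

  -- prefix x z p = ⌊(z + Σᵢ xᵢ b^-(i+1)) b^p⌋ when x is a digit sequence.
  prefix : (ℕ → ℕ) → ℤ → ℕ → ℤ
  prefix x z p = + value p x ℤ.+ z ℤ.* + (b ^ p)

  prefix-snoc : ∀ x z p → prefix x z (suc p) ≡ prefix x z p ℤ.* + b ℤ.+ + x p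
  prefix-snoc x z p = begin
    + value (suc p) x ℤ.+ z ℤ.* + (b * b ^ p)
      ≡⟨ cong₂ (λ v q → v ℤ.+ z ℤ.* q) (+value-snoc p x) (ℤₚ.pos-* b (b ^ p)) ⟩
    (+ value p x ℤ.* + b ℤ.+ + x p) ℤ.+ z ℤ.* (+ b ℤ.* + (b ^ p))
      ≡⟨ horner (+ value p x) (+ x p) z (+ b) (+ (b ^ p)) ⟩
    (+ value p x ℤ.+ z ℤ.* + (b ^ p)) ℤ.* + b ℤ.+ + x p ∎
    where
    open ≡-Reasoning
    horner : ∀ v d z B P → (v ℤ.* B ℤ.+ d) ℤ.+ z ℤ.* (B ℤ.* P) ≡ (v ℤ.+ z ℤ.* P) ℤ.* B ℤ.+ d
    horner = solve-∀

  value-rescale : ∀ m p x → (∀ i → m ≤ i → x i ≡ 0) →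
                  value m x * b ^ p ≡ value p x * b ^ m + value m (x ∘ (_+_ p))
  value-rescale m p x x≡0 = begin
    value m x * b ^ p                                 ≡⟨ ℕₚ.+-identityʳ _ ⟨
    value m x * b ^ p + 0                             ≡⟨ cong (_+_ (value m x * b ^ p)) tail≡0 ⟨
    value m x * b ^ p + value p (x ∘ (_+_ m))         ≡⟨ value-++ m p x ⟨
    value (m + p) x                                   ≡⟨ cong (λ n → value n x) (ℕₚ.+-comm m p) ⟩
    value (p + m) x                                   ≡⟨ value-++ p m x ⟩
    value p x * b ^ m + value m (x ∘ (_+_ p))         ∎
    where
    open ≡-Reasoning
    tail≡0 : value p (x ∘ (_+_ m)) ≡ 0
    tail≡0 = value-vanishes p (λ i _ → x≡0 (m + i) (ℕₚ.m≤m+n m i))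

  prefix-rescale : ∀ m p x z → (∀ i → m ≤ i → x i ≡ 0) →
    prefix x z m ℤ.* + (b ^ p) ≡ prefix x z p ℤ.* + (b ^ m) ℤ.+ + value m (x ∘ (_+_ p))
  prefix-rescale m p x z x≡0 = begin
    (V ℤ.+ z ℤ.* M) ℤ.* P         ≡⟨ expand V z M P ⟩
    V ℤ.* P ℤ.+ z ℤ.* (P ℤ.* M)   ≡⟨ cong (ℤ._+ z ℤ.* (P ℤ.* M)) rescaled ⟩
    (W ℤ.* M ℤ.+ R) ℤ.+ z ℤ.* (P ℤ.* M) ≡⟨ collect W R z M P ⟩
    (W ℤ.+ z ℤ.* P) ℤ.* M ℤ.+ R   ∎
    where
    open ≡-Reasoning
    V W R M P : ℤ
    V = + value m x
    W = + value p x
    R = + value m (x ∘ (_+_ p))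
    M = + (b ^ m)
    P = + (b ^ p)
    rescaled : V ℤ.* P ≡ W ℤ.* M ℤ.+ R
    rescaled = begin
      V ℤ.* P                                        ≡⟨ ℤₚ.pos-* (value m x) (b ^ p) ⟨
      + (value m x * b ^ p)                          ≡⟨ cong +_ (value-rescale m p x x≡0) ⟩
      + (value p x * b ^ m + value m (x ∘ (_+_ p)))  ≡⟨ pos-*+ (value p x) (b ^ m) _ ⟩
      W ℤ.* M ℤ.+ R                                  ∎
    expand : ∀ V z M P → (V ℤ.+ z ℤ.* M) ℤ.* P ≡ V ℤ.* P ℤ.+ z ℤ.* (P ℤ.* M)
    expand = solve-∀
    collect : ∀ W R z M P → (W ℤ.* M ℤ.+ R) ℤ.+ z ℤ.* (P ℤ.* M) ≡ (W ℤ.+ z ℤ.* P) ℤ.* M ℤ.+ R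
    collect = solve-∀

  InWindow : ℤ → ℤ → Set
  InWindow L q = L ℤ.≤ q × q ℤ.< L ℤ.+ + b

  window : ∀ m p {x} z L → Digits x → (∀ i → m ≤ i → x i ≡ 0) →
           L ℤ.* + (b ^ m) ℤ.≤ prefix x z m ℤ.* + (b ^ p) →
           prefix x z m ℤ.* + (b ^ p) ℤ.< (L ℤ.+ + b) ℤ.* + (b ^ m) →
           InWindow L (prefix x z p)
  window m p {x} z L x<b x≡0 lo hi =
      quotient-lowerBound (b ^ m) (value<b^ m (x<b ∘ (_+_ p))) (subst (L ℤ.* + (b ^ m) ℤ.≤_) rescale lo)
    , quotient-upperBound (b ^ m) (subst (ℤ._< (L ℤ.+ + b) ℤ.* + (b ^ m)) rescale hi)
    where
    rescale : prefix x z m ℤ.* + (b ^ p) ≡ prefix x z p ℤ.* + (b ^ m) ℤ.+ + value m (x ∘ (_+_ p))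
    rescale = prefix-rescale m p x z x≡0

  b∣0 : + b ∣ + 0
  b∣0 = divides (+ 0) refl

  b∣x-x : ∀ x → + b ∣ x - x
  b∣x-x x = subst (+ b ∣_) (sym (ℤₚ.+-inverseʳ x)) b∣0

  small-multiple : ∀ {n} → n < b → b ∣ℕ n → n ≡ 0
  small-multiple {zero}  _   _   = refl
  small-multiple {suc n} n<b b∣n = contradiction b∣n (>⇒∤ n<b)

  digit-≡ : ∀ {x y} → x < b → y < b → + b ∣ + x - + y → x ≡ y
  digit-≡ {x} {y} x<b y<b b∣x-y =
    ℤₚ.+-injective (ℤₚ.i-j≡0⇒i≡j (+ x) (+ y) (ℤₚ.∣i∣≡0⇒i≡0 ∣x-y∣≡0))
    where
    ∣x-y∣<b : ℤ.∣ + x - + y ∣ < b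
    ∣x-y∣<b = subst (_< b) (cong ℤ.∣_∣ (sym (ℤₚ.m-n≡m⊖n x y)))
                (ℕₚ.≤-<-trans (ℤₚ.∣m⊝n∣≤m⊔n x y) (ℕₚ.⊔-lub x<b y<b))
    ∣x-y∣≡0 : ℤ.∣ + x - + y ∣ ≡ 0
    ∣x-y∣≡0 = small-multiple ∣x-y∣<b (∣⇒∣ᵤ b∣x-y)

  -- Modulo b the sequence d₀ … d_c has the shape 0 … 0 s … s t with s, t ≢ 0 (or is all 0).
  record CarryShaped (c : ℕ) (d : ℕ → ℤ) : Set where
    field
      propagate : ∀ k → 2 + k ≤ c → ¬ (+ b ∣ d k) → + b ∣ d (suc k) - d k
      last      : ∀ k → suc k ≡ c → ¬ (+ b ∣ d k) → ¬ (+ b ∣ d c)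

  module _ {c : ℕ} {d : ℕ → ℤ} (shape : CarryShaped c d) where
    open CarryShaped shape

    divisible-pred : ∀ {k} → suc k ≤ c → + b ∣ d (suc k) → + b ∣ d k
    divisible-pred {k} k<c b∣d[1+k] with + b ∣? d k
    ... | yes b∣dk = b∣dk
    ... | no  b∤dk with ℕₚ.m≤n⇒m<n∨m≡n k<c
    ...   | inj₁ 2+k≤c = ∣m-n∣m⇒∣n (propagate k 2+k≤c b∤dk) b∣d[1+k]
    ...   | inj₂ refl  = contradiction b∣d[1+k] (last k refl b∤dk)

    divisible-downward : ∀ {j} → j ≤ c → + b ∣ d j → ∀ {k} → k ≤ j → + b ∣ d k
    divisible-downward j≤c b∣dj =
      downwardInduction (λ k → + b ∣ d k) b∣dj (λ k<j → divisible-pred (ℕₚ.≤-trans k<j j≤c))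

  carryShaped-respects-mod : ∀ {c d d'} → (∀ k → k ≤ c → + b ∣ d k - d' k) →
                             CarryShaped c d → CarryShaped c d'
  carryShaped-respects-mod {c} {d} {d'} d≡d' shape = record { propagate = propagate′ ; last = last′ }
    where
    open CarryShaped shape
    to : ∀ {k} → k ≤ c → + b ∣ d k → + b ∣ d' k
    to {k} k≤c = ∣m-n∣m⇒∣n (d≡d' k k≤c)
    from : ∀ {k} → k ≤ c → + b ∣ d' k → + b ∣ d k
    from {k} k≤c = ∣m-n∣n⇒∣m (d≡d' k k≤c)
    propagate′ : ∀ k → 2 + k ≤ c → ¬ (+ b ∣ d' k) → + b ∣ d' (suc k) - d' k
    propagate′ k 2+k≤c b∤d'k =
      subst (+ b ∣_) (regroup (d (suc k)) (d k) (d' (suc k)) (d' k))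
        (∣m∣n⇒∣m+n (∣m∣n⇒∣m-n (propagate k 2+k≤c (b∤d'k ∘ to k≤c)) (d≡d' (suc k) 1+k≤c))
                   (d≡d' k k≤c))
      where
      1+k≤c : suc k ≤ c
      1+k≤c = ℕₚ.<⇒≤ 2+k≤c
      k≤c : k ≤ c
      k≤c = ℕₚ.<⇒≤ 1+k≤c
      regroup : ∀ u v u' v' → ((u - v) - (u - u')) ℤ.+ (v - v') ≡ u' - v'
      regroup = solve-∀
    last′ : ∀ k → suc k ≡ c → ¬ (+ b ∣ d' k) → ¬ (+ b ∣ d' c)
    last′ k refl b∤d'k b∣d'c =
      last k refl (b∤d'k ∘ to (ℕₚ.n≤1+n k)) (from ℕₚ.≤-refl b∣d'c)

  carryShaped-neg : ∀ {c d} → CarryShaped c d → CarryShaped c (λ k → - d k)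
  carryShaped-neg {c} {d} shape = record { propagate = propagate′ ; last = last′ }
    where
    open CarryShaped shape
    propagate′ : ∀ k → 2 + k ≤ c → ¬ (+ b ∣ - d k) → + b ∣ - d (suc k) - - d k
    propagate′ k 2+k≤c b∤-dk =
      subst (+ b ∣_) (-[u-v]≡-u--v (d (suc k)) (d k))
        (∣m⇒∣-m (propagate k 2+k≤c (b∤-dk ∘ ∣m⇒∣-m)))
      where
      -[u-v]≡-u--v : ∀ u v → - (u - v) ≡ - u - - v
      -[u-v]≡-u--v = solve-∀
    last′ : ∀ k → suc k ≡ c → ¬ (+ b ∣ - d k) → ¬ (+ b ∣ - d c)
    last′ k 1+k≡c b∤-dk = last k 1+k≡c (b∤-dk ∘ ∣m⇒∣-m) ∘ ∣-m⇒∣m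

  carry≤1 : ∀ {e' e x x'} → e' ≤ b → x' < b → e' + x' ≡ e * b + x → e ≤ 1
  carry≤1 {e'} {e} {x} {x'} e'≤b x'<b carry = ℕₚ.≤-pred (ℕₚ.*-cancelʳ-< b e 2 eb<2b)
    where
    open ℕₚ.≤-Reasoning
    eb<2b : e * b < 2 * b
    eb<2b = begin-strict
      e * b      ≤⟨ ℕₚ.m≤m+n (e * b) x ⟩
      e * b + x  ≡⟨ carry ⟨
      e' + x'    <⟨ ℕₚ.+-mono-≤-< e'≤b x'<b ⟩
      b + b      ≡⟨ cong (_+_ b) (ℕₚ.+-identityʳ b) ⟨
      2 * b      ∎

  carries⇒carryShaped : ∀ {c} (e x x' : ℕ → ℕ) → Digits x' →
    (∀ i → i ≤ c → e (suc i) + x' i ≡ e i * b + x i) → e (suc c) < b →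
    CarryShaped c (λ i → + x i - + x' i)
  carries⇒carryShaped {c} e x x' x'<b carry e[1+c]<b =
    carryShaped-respects-mod carry≡digit (record { propagate = propagate ; last = last })
    where
    e≤1 : ∀ {i} → i ≤ c → e i ≤ 1
    e≤1 = downwardInduction (λ i → e i ≤ 1)
            (carry≤1 (ℕₚ.<⇒≤ e[1+c]<b) (x'<b c) (carry c ℕₚ.≤-refl))
            (λ {i} i<c e[1+i]≤1 →
               carry≤1 (ℕₚ.≤-trans e[1+i]≤1 (s≤s z≤n)) (x'<b i) (carry i (ℕₚ.<⇒≤ i<c)))

    carry-persists : ∀ {i} → i ≤ c → e i ≡ 1 → 0 < e (suc i)
    carry-persists {i} i≤c e[i]≡1 = ℕₚ.n≢0⇒n>0 λ e[1+i]≡0 → ℕₚ.<⇒≱ (x'<b i) (begin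
      b                  ≤⟨ ℕₚ.m≤m+n b (x i) ⟩
      b + x i            ≡⟨ cong (_+ x i) (ℕₚ.*-identityˡ b) ⟨
      1 * b + x i        ≡⟨ cong (λ u → u * b + x i) e[i]≡1 ⟨
      e i * b + x i      ≡⟨ carry i i≤c ⟨
      e (suc i) + x' i   ≡⟨ cong (_+ x' i) e[1+i]≡0 ⟩
      x' i               ∎)
      where open ℕₚ.≤-Reasoning

    carry≡digit : ∀ k → k ≤ c → + b ∣ + e (suc k) - (+ x k - + x' k)
    carry≡digit k k≤c = divides (+ e k) (begin
      + e (suc k) - (+ x k - + x' k)        ≡⟨ regroup (+ e (suc k)) (+ x k) (+ x' k) ⟩
      (+ e (suc k) ℤ.+ + x' k) - + x k      ≡⟨ cong (_- + x k) (ℤₚ.pos-+ (e (suc k)) (x' k)) ⟨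
      + (e (suc k) + x' k) - + x k          ≡⟨ cong (λ n → + n - + x k) (carry k k≤c) ⟩
      + (e k * b + x k) - + x k             ≡⟨ cong (_- + x k) (pos-*+ (e k) b (x k)) ⟩
      (+ e k ℤ.* + b ℤ.+ + x k) - + x k     ≡⟨ cancel (+ e k ℤ.* + b) (+ x k) ⟩
      + e k ℤ.* + b                         ∎)
      where
      open ≡-Reasoning
      regroup : ∀ e x x' → e - (x - x') ≡ (e ℤ.+ x') - x
      regroup = solve-∀
      cancel : ∀ u v → (u ℤ.+ v) - v ≡ u
      cancel = solve-∀

    carry≡1 : ∀ {i} → i ≤ c → ¬ (+ b ∣ + e i) → e i ≡ 1
    carry≡1 i≤c b∤e with ℕₚ.n≤1⇒n≡0∨n≡1 (e≤1 i≤c)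
    ... | inj₁ e≡0 = contradiction (subst (λ n → + b ∣ + n) (sym e≡0) b∣0) b∤e
    ... | inj₂ e≡1 = e≡1

    propagate : ∀ k → 2 + k ≤ c → ¬ (+ b ∣ + e (suc k)) → + b ∣ + e (suc (suc k)) - + e (suc k)
    propagate k 2+k≤c b∤e =
      subst (+ b ∣_) (cong₂ (λ u v → + u - + v) (sym e[2+k]≡1) (sym e[1+k]≡1)) (b∣x-x (+ 1))
      where
      1+k≤c : suc k ≤ c
      1+k≤c = ℕₚ.<⇒≤ 2+k≤c
      e[1+k]≡1 : e (suc k) ≡ 1
      e[1+k]≡1 = carry≡1 1+k≤c b∤e
      e[2+k]≡1 : e (suc (suc k)) ≡ 1
      e[2+k]≡1 = ℕₚ.≤-antisym (e≤1 2+k≤c) (carry-persists 1+k≤c e[1+k]≡1)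

    last : ∀ k → suc k ≡ c → ¬ (+ b ∣ + e (suc k)) → ¬ (+ b ∣ + e (suc c))
    last k refl b∤e b∣e[1+c] = ℕₚ.<⇒≢ (carry-persists ℕₚ.≤-refl (carry≡1 ℕₚ.≤-refl b∤e))
                                  (sym (small-multiple e[1+c]<b (∣⇒∣ᵤ b∣e[1+c])))

  carry-nonneg : ∀ {E E' x x'} → x < b → E' ℤ.+ + x' ≡ E ℤ.* + b ℤ.+ + x →
                 + 0 ℤ.≤ E' → + 0 ℤ.≤ E
  carry-nonneg {E} {E'} {x} {x'} x<b carry 0≤E' =
    ℤₚ.i<j⇒suc[i]≤j {ℤ.-1ℤ} (ℤₚ.*-cancelʳ-<-nonNeg {ℤ.-1ℤ} {E} (+ b) (begin-strict
      ℤ.-1ℤ ℤ.* + b               ≡⟨ -1*u≡-u (+ b) ⟩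
      - + b                       <⟨ ℤₚ.neg-mono-< (ℤ.+<+ x<b) ⟩
      - + x                       ≡⟨ ℤₚ.+-identityˡ (- + x) ⟨
      + 0 - + x                   ≤⟨ ℤₚ.+-monoˡ-≤ (- + x) (ℤₚ.+-mono-≤ 0≤E' (ℤ.+≤+ z≤n)) ⟩
      (E' ℤ.+ + x') - + x         ≡⟨ cong (_- + x) carry ⟩
      (E ℤ.* + b ℤ.+ + x) - + x   ≡⟨ cancel (E ℤ.* + b) (+ x) ⟩
      E ℤ.* + b                   ∎))
    where
    open ℤₚ.≤-Reasoning
    -1*u≡-u : ∀ u → ℤ.-1ℤ ℤ.* u ≡ - u
    -1*u≡-u = solve-∀
    cancel : ∀ u v → (u ℤ.+ v) - v ≡ u
    cancel = solve-∀

  integerCarries⇒carryShaped : ∀ {c} (E : ℕ → ℤ) {x x'} → Digits x → Digits x' →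
    (∀ i → E (suc i) ℤ.+ + x' i ≡ E i ℤ.* + b ℤ.+ + x i) →
    + 0 ℤ.≤ E (suc c) → E (suc c) ℤ.< + b →
    CarryShaped c (λ i → + x i - + x' i)
  integerCarries⇒carryShaped {c} E {x} {x'} x<b x'<b carry 0≤E[1+c] E[1+c]<b =
    carries⇒carryShaped (ℤ.∣_∣ ∘ E) x x' x'<b carryℕ
      (ℤₚ.drop‿+<+ (subst (ℤ._< + b) (sym (+∣E∣≡E ℕₚ.≤-refl)) E[1+c]<b))
    where
    +∣E∣≡E : ∀ {i} → i ≤ suc c → + ℤ.∣ E i ∣ ≡ E i
    +∣E∣≡E i≤1+c = ℤₚ.0≤i⇒+∣i∣≡i
      (downwardInduction (λ i → + 0 ℤ.≤ E i) 0≤E[1+c]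
         (λ {i} _ → carry-nonneg (x<b i) (carry i)) i≤1+c)
    carryℕ : ∀ i → i ≤ c → ℤ.∣ E (suc i) ∣ + x' i ≡ ℤ.∣ E i ∣ * b + x i
    carryℕ i i≤c = ℤₚ.+-injective (begin
      + (ℤ.∣ E (suc i) ∣ + x' i)        ≡⟨ ℤₚ.pos-+ (ℤ.∣ E (suc i) ∣) (x' i) ⟩
      + ℤ.∣ E (suc i) ∣ ℤ.+ + x' i      ≡⟨ cong (ℤ._+ + x' i) (+∣E∣≡E (s≤s i≤c)) ⟩
      E (suc i) ℤ.+ + x' i              ≡⟨ carry i ⟩
      E i ℤ.* + b ℤ.+ + x i
        ≡⟨ cong (λ u → u ℤ.* + b ℤ.+ + x i) (+∣E∣≡E (ℕₚ.m≤n⇒m≤1+n i≤c)) ⟨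
      + ℤ.∣ E i ∣ ℤ.* + b ℤ.+ + x i     ≡⟨ pos-*+ (ℤ.∣ E i ∣) b (x i) ⟨
      + (ℤ.∣ E i ∣ * b + x i)           ∎)
      where open ≡-Reasoning

  InWindow-gap : ∀ {L q q'} → InWindow L q → InWindow L q' → q - q' ℤ.< + b
  InWindow-gap {L} {q} {q'} (_ , q<L+b) (L≤q' , _) = begin-strict
    q - q'           ≤⟨ ℤₚ.+-monoʳ-≤ q (ℤₚ.neg-mono-≤ L≤q') ⟩
    q - L            <⟨ ℤₚ.+-monoˡ-< (- L) q<L+b ⟩
    (L ℤ.+ + b) - L  ≡⟨ cancel L (+ b) ⟩
    + b              ∎
    where
    open ℤₚ.≤-Reasoning
    cancel : ∀ u v → (u ℤ.+ v) - u ≡ v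
    cancel = solve-∀

  prefixGap⇒carryShaped : ∀ {c x x'} z z' → Digits x → Digits x' →
    prefix x' z' (suc c) ℤ.≤ prefix x z (suc c) → prefix x z (suc c) - prefix x' z' (suc c) ℤ.< + b →
    CarryShaped c (λ i → + x i - + x' i)
  prefixGap⇒carryShaped {c} {x} {x'} z z' x<b x'<b q'≤q q-q'<b =
    integerCarries⇒carryShaped (λ i → prefix x z i - prefix x' z' i) x<b x'<b carry
      (ℤₚ.i≤j⇒0≤j-i q'≤q) q-q'<b
    where
    carry : ∀ i → (prefix x z (suc i) - prefix x' z' (suc i)) ℤ.+ + x' i
                  ≡ (prefix x z i - prefix x' z' i) ℤ.* + b ℤ.+ + x i
    carry i rewrite prefix-snoc x z i | prefix-snoc x' z' i =
      regroup (prefix x z i) (prefix x' z' i) (+ b) (+ x i) (+ x' i)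
      where
      regroup : ∀ q q' B d d' → ((q ℤ.* B ℤ.+ d) - (q' ℤ.* B ℤ.+ d')) ℤ.+ d' ≡ (q - q') ℤ.* B ℤ.+ d
      regroup = solve-∀

  sameWindow⇒carryShaped : ∀ {c x x'} z z' {L} → Digits x → Digits x' →
    InWindow L (prefix x z (suc c)) → InWindow L (prefix x' z' (suc c)) →
    CarryShaped c (λ i → + x i - + x' i)
  sameWindow⇒carryShaped {c} {x} {x'} z z' x<b x'<b w w'
    with prefix x' z' (suc c) ℤₚ.≤? prefix x z (suc c)
  ... | yes q'≤q = prefixGap⇒carryShaped z z' x<b x'<b q'≤q (InWindow-gap w w')
  ... | no  q'≰q = carryShaped-respects-mod negated-swap
      (carryShaped-neg
        (prefixGap⇒carryShaped z' z x'<b x<b (ℤₚ.<⇒≤ (ℤₚ.≰⇒> q'≰q)) (InWindow-gap w' w)))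
    where
    negated-swap : ∀ k → k ≤ c → + b ∣ - (+ x' k - + x k) - (+ x k - + x' k)
    negated-swap k _ = subst (+ b ∣_) (sym (-[u-v]-[v-u]≡0 (+ x' k) (+ x k))) b∣0
      where
      -[u-v]-[v-u]≡0 : ∀ u v → - (u - v) - (v - u) ≡ + 0
      -[u-v]-[v-u]≡0 = solve-∀

  inInt⇒InWindow : ∀ {m c a e x} z → Digits x → (∀ i → m ≤ i → x i ≡ 0) →
    inInt b m c a e (prefix x z m) → InWindow (+ (a * b) - + e) (prefix x z (suc c))
  inInt⇒InWindow {m} {c} {a} {e} {x} z x<b x≡0 (lo , hi) =
    window m (suc c) z (+ (a * b) - + e) x<b x≡0 lo
      (subst (λ R → prefix x z m ℤ.* + (b ^ suc c) ℤ.< R ℤ.* + (b ^ m)) upper≡ hi)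
    where
    upper≡ : + (a * b + b) - + e ≡ (+ (a * b) - + e) ℤ.+ + b
    upper≡ = trans (cong (_- + e) (ℤₚ.pos-+ (a * b) b)) (shuffle (+ (a * b)) (+ b) (+ e))
      where
      shuffle : ∀ u v w → (u ℤ.+ v) - w ≡ (u - w) ℤ.+ v
      shuffle = solve-∀

  sameInterval⇒carryShaped : ∀ {m c a e x x'} → Digits x → Digits x' →
    (∀ i → m ≤ i → x i ≡ 0) → (∀ i → m ≤ i → x' i ≡ 0) →
    inTor b m c a e (+ value m x) → inTor b m c a e (+ value m x') →
    CarryShaped c (λ i → + x i - + x' i)
  sameInterval⇒carryShaped {m} {c} {a} {e} {x} {x'} x<b x'<b x≡0 x'≡0 (z , J∋x) (z' , J∋x') =
    sameWindow⇒carryShaped z z' x<b x'<b (inInt⇒InWindow {m} {c} {a} {e} z x<b x≡0 J∋x)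
                                        (inInt⇒InWindow {m} {c} {a} {e} z' x'<b x'≡0 J∋x')

  truncate : ℕ → (ℕ → ℕ) → ℕ → ℕ
  truncate m g k with k <? m
  ... | yes _ = g k
  ... | no  _ = 0

  truncate-< : ∀ {m} g {k} → k < m → truncate m g k ≡ g k
  truncate-< {m} g {k} k<m with k <? m
  ... | yes _   = refl
  ... | no  k≮m = contradiction k<m k≮m

  truncate-≥ : ∀ {m} g {k} → m ≤ k → truncate m g k ≡ 0
  truncate-≥ {m} g {k} m≤k with k <? m
  ... | yes k<m = contradiction k<m (ℕₚ.≤⇒≯ m≤k)
  ... | no  _   = refl

  truncate-digits : ∀ {m g} → Digits g → Digits (truncate m g)
  truncate-digits {m} g<b k with k <? m
  ... | yes _ = g<b k
  ... | no  _ = s≤s z≤n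

  rowSum : ℕ → (ℕ → ℕ → ℕ) → ℕ → ℕ → ℕ
  rowSum m F n k = Σfin m (λ l → F k (toℕ l) * digit b (toℕ l) n)

  shiftDigit : ℕ → ℕ → ℕ
  shiftDigit r δ = (r % b + δ) % b

  -- The digits (most significant first) of a coordinate of point n of Q(F) ⊕ D/b^m, padded with
  -- zeros from position m on.
  netDigits : ℕ → (ℕ → ℕ → ℕ) → ℕ → ℕ → ℕ → ℕ
  netDigits m F D n = truncate m (λ k → shiftDigit (rowSum m F n k) (digit b (m ∸ suc k) D))

  shiftedNum≡value : ∀ m F D n →
    shiftedNum b m (λ k l → F (toℕ k) (toℕ l)) D n ≡ value m (netDigits m F D n)
  shiftedNum≡value m F D n = sym (value-cong m (λ k k<m → truncate-< _ k<m))

  sameInterval⇒netCarryShaped : ∀ {m c a e} F D n n' →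
    inTor b m c a e (+ shiftedNum b m (λ k l → F (toℕ k) (toℕ l)) D n) →
    inTor b m c a e (+ shiftedNum b m (λ k l → F (toℕ k) (toℕ l)) D n') →
    CarryShaped c (λ i → + netDigits m F D n i - + netDigits m F D n' i)
  sameInterval⇒netCarryShaped {m} {c} {a} {e} F D n n' J∋n J∋n' =
    sameInterval⇒carryShaped {m} {c} {a} {e} (netDigits-digits n) (netDigits-digits n')
      (λ _ → truncate-≥ _) (λ _ → truncate-≥ _)
      (subst (λ X → inTor b m c a e (+ X)) (shiftedNum≡value m F D n) J∋n)
      (subst (λ X → inTor b m c a e (+ X)) (shiftedNum≡value m F D n') J∋n')
    where
    netDigits-digits : ∀ n → Digits (netDigits m F D n)
    netDigits-digits n = truncate-digits {m} (λ k → m%n<n (rowSum m F n k % b + digit b (m ∸ suc k) D) b)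

  %b-≡ : ∀ y → + b ∣ + (y % b) - + y
  %b-≡ y = divides (- + (y / b)) (begin
    + (y % b) - + y                               ≡⟨ cong (λ t → + (y % b) - + t) (m≡m%n+[m/n]*n y b) ⟩
    + (y % b) - + (y % b + y / b * b)             ≡⟨ cong (_-_ (+ (y % b))) (ℤₚ.pos-+ (y % b) (y / b * b)) ⟩
    + (y % b) - (+ (y % b) ℤ.+ + (y / b * b))     ≡⟨ cancel (+ (y % b)) (+ (y / b * b)) ⟩
    - + (y / b * b)                               ≡⟨ cong -_ (ℤₚ.pos-* (y / b) b) ⟩
    - (+ (y / b) ℤ.* + b)                         ≡⟨ ℤₚ.neg-distribˡ-* (+ (y / b)) (+ b) ⟩
    - + (y / b) ℤ.* + b                           ∎)
    where
    open ≡-Reasoning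
    cancel : ∀ r q → r - (r ℤ.+ q) ≡ - q
    cancel = solve-∀

  shiftDigit-≡ : ∀ r δ → + b ∣ + shiftDigit r δ - (+ r ℤ.+ + δ)
  shiftDigit-≡ r δ =
    subst (+ b ∣_) (telescope (+ shiftDigit r δ) (+ (r % b)) (+ r) (+ δ))
      (∣m∣n⇒∣m+n (subst (λ t → + b ∣ + shiftDigit r δ - t) (ℤₚ.pos-+ (r % b) δ) (%b-≡ (r % b + δ)))
                 (%b-≡ r))
    where
    telescope : ∀ s r' r δ → (s - (r' ℤ.+ δ)) ℤ.+ (r' - r) ≡ s - (r ℤ.+ δ)
    telescope = solve-∀

  shiftDigit-cancel : ∀ r r' δ → + b ∣ (+ shiftDigit r δ - + shiftDigit r' δ) - (+ r - + r')
  shiftDigit-cancel r r' δ =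
    subst (+ b ∣_) (regroup (+ shiftDigit r δ) (+ shiftDigit r' δ) (+ r) (+ r') (+ δ))
      (∣m∣n⇒∣m-n (shiftDigit-≡ r δ) (shiftDigit-≡ r' δ))
    where
    regroup : ∀ s s' r r' δ → (s - (r ℤ.+ δ)) - (s' - (r' ℤ.+ δ)) ≡ (s - s') - (r - r')
    regroup = solve-∀

  netDigits-difference : ∀ m F D {n n'} k {r r'} →
    truncate m (rowSum m F n) k ≡ r → truncate m (rowSum m F n') k ≡ r' →
    + b ∣ (+ netDigits m F D n k - + netDigits m F D n' k) - (+ r - + r')
  netDigits-difference m F D {n} {n'} k refl refl with k <? m
  ... | yes _ = shiftDigit-cancel (rowSum m F n k) (rowSum m F n' k) (digit b (m ∸ suc k) D)
  ... | no  _ = b∣0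

  module PartialSums {c t : ℕ} {v T : ℕ → ℤ} (2+t≤c : 2 + t ≤ c)
    (T-zero : T 0 ≡ + 0) (T-suc : ∀ j → j < suc (suc c) + t → T (suc j) ≡ T j ℤ.+ v j)
    (v-shape : CarryShaped (suc c) v) (T-shape : CarryShaped (suc c) (λ k → T (suc (suc c) + t ∸ k)))
    where

    private
      m : ℕ
      m = suc (suc c) + t

    open CarryShaped

    v≡ΔT : ∀ j → j < m → T (suc j) - T j ≡ v j
    v≡ΔT j j<m = trans (cong (_- T j) (T-suc j j<m)) (cancel (T j) (v j))
      where
      cancel : ∀ u w → (u ℤ.+ w) - u ≡ w
      cancel = solve-∀

    b∣T-after-borrow : ∀ k → 2 + k ≤ suc c → ¬ (+ b ∣ v (m ∸ suc k)) → + b ∣ T (m ∸ k)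
    b∣T-after-borrow k 2+k≤1+c b∤v with + b ∣? T (m ∸ k)
    ... | yes b∣T = b∣T
    ... | no  b∤T =
      contradiction (∣-m⇒∣m (subst (+ b ∣_) ΔT≡-v (propagate T-shape k 2+k≤1+c b∤T))) b∤v
      where
      i : ℕ
      i = m ∸ suc k
      k≤1+c+t : k ≤ suc c + t
      k≤1+c+t = ℕₚ.≤-trans (ℕₚ.m+n≤o⇒n≤o 2 2+k≤1+c) (ℕₚ.m≤m+n (suc c) t)
      m∸k≡1+i : m ∸ k ≡ suc i
      m∸k≡1+i = ℕₚ.+-∸-assoc 1 k≤1+c+t
      ΔT≡-v : T i - T (m ∸ k) ≡ - v i
      ΔT≡-v = begin
        T i - T (m ∸ k)         ≡⟨ cong (λ j → T i - T j) m∸k≡1+i ⟩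
        T i - T (suc i)         ≡⟨ cong (_-_ (T i)) (T-suc i (s≤s (ℕₚ.m∸n≤m (suc c + t) k))) ⟩
        T i - (T i ℤ.+ v i)     ≡⟨ cancel (T i) (v i) ⟩
        - v i                   ∎
        where
        open ≡-Reasoning
        cancel : ∀ u w → u - (u ℤ.+ w) ≡ - w
        cancel = solve-∀

    b∣v[c] : + b ∣ v c
    b∣v[c] with + b ∣? v c
    ... | yes b∣v = b∣v
    ... | no  b∤v = contradiction b∣v[1+c] (last v-shape c refl b∤v)
      where
      b∣T[1+c] : + b ∣ T (suc c)
      b∣T[1+c] = subst (λ j → + b ∣ T j) (ℕₚ.m+n∸n≡m (suc c) t)
        (b∣T-after-borrow (suc t) (s≤s 2+t≤c)
          (subst (λ j → ¬ (+ b ∣ v j)) (sym (ℕₚ.m+n∸n≡m c t)) b∤v))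
      b∣T[2+c] : + b ∣ T (suc (suc c))
      b∣T[2+c] = subst (λ j → + b ∣ T j) (ℕₚ.m+n∸n≡m (suc (suc c)) t)
        (b∣T-after-borrow t (ℕₚ.m≤n⇒m≤1+n 2+t≤c)
          (subst (λ j → ¬ (+ b ∣ v j)) (sym (ℕₚ.m+n∸n≡m (suc c) t)) (last v-shape c refl b∤v)))
      b∣v[1+c] : + b ∣ v (suc c)
      b∣v[1+c] = subst (+ b ∣_) (v≡ΔT (suc c) (s≤s (s≤s (ℕₚ.m≤m+n c t))))
                   (∣m∣n⇒∣m-n b∣T[2+c] b∣T[1+c])

    b∣T-low : ∀ {j} → j ≤ suc c → + b ∣ T j
    b∣T-low {zero}  _     = subst (+ b ∣_) (sym T-zero) b∣0
    b∣T-low {suc j} j<1+c =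
      subst (+ b ∣_) (sym (T-suc j (ℕₚ.<-≤-trans j<1+c (ℕₚ.m≤n⇒m≤1+n (ℕₚ.m≤m+n (suc c) t)))))
        (∣m∣n⇒∣m+n (b∣T-low (ℕₚ.<⇒≤ j<1+c))
                   (divisible-downward v-shape (ℕₚ.n≤1+n c) b∣v[c] (ℕₚ.≤-pred j<1+c)))

    b∣T-high : ∀ {k} → k ≤ c → + b ∣ T (m ∸ k)
    b∣T-high = divisible-downward T-shape (ℕₚ.n≤1+n c)
      (subst (λ j → + b ∣ T j) (sym m∸c≡2+t) (b∣T-low (ℕₚ.m≤n⇒m≤1+n 2+t≤c)))
      where
      m∸c≡2+t : m ∸ c ≡ 2 + t
      m∸c≡2+t = trans (cong (_∸ c) (sym (trans (ℕₚ.+-suc c (suc t)) (cong suc (ℕₚ.+-suc c t)))))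
                      (ℕₚ.m+n∸m≡n c (2 + t))

    b∣T : ∀ j → j ≤ m → + b ∣ T j
    b∣T j j≤m with j ≤? suc c
    ... | yes j≤1+c = b∣T-low j≤1+c
    ... | no  j≰1+c = subst (λ i → + b ∣ T i) (ℕₚ.m∸[m∸n]≡n j≤m) (b∣T-high m∸j≤c)
      where
      m∸j≤c : m ∸ j ≤ c
      m∸j≤c = ℕₚ.≤-trans (ℕₚ.∸-monoʳ-≤ m (ℕₚ.≰⇒> j≰1+c))
                (ℕₚ.≤-trans (ℕₚ.≤-reflexive (ℕₚ.m+n∸m≡n (suc (suc c)) t)) (ℕₚ.m+n≤o⇒n≤o 2 2+t≤c))

    digitDifferences-divisible : ∀ l → l < m → + b ∣ v l
    digitDifferences-divisible l l<m =
      subst (+ b ∣_) (v≡ΔT l l<m) (∣m∣n⇒∣m-n (b∣T (suc l) l<m) (b∣T l (ℕₚ.<⇒≤ l<m)))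

  partialSums⇒divisible : ∀ {m c t} {v T : ℕ → ℤ} → suc (suc c) + t ≡ m → 2 + t ≤ c →
    T 0 ≡ + 0 → (∀ j → j < m → T (suc j) ≡ T j ℤ.+ v j) →
    CarryShaped (suc c) v → CarryShaped (suc c) (λ k → T (m ∸ k)) → ∀ l → l < m → + b ∣ v l
  partialSums⇒divisible {v = v} {T} refl = PartialSums.digitDifferences-divisible {v = v} {T}

  ⌈m/2⌉-split : ∀ m → ⌈ m /2⌉ + 1 < m →
    let c = ⌈ m /2⌉ in suc (suc c) + (m ∸ suc (suc c)) ≡ m × 2 + (m ∸ suc (suc c)) ≤ c
  ⌈m/2⌉-split m κ<m = m≡ , ℕₚ.+-cancelˡ-≤ c (2 + t) c (begin
      c + (2 + t)  ≡⟨ ℕₚ.+-suc c (suc t) ⟩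
      suc (c + suc t) ≡⟨ cong suc (ℕₚ.+-suc c t) ⟩
      suc (suc c) + t ≡⟨ m≡ ⟩
      m            ≤⟨ m≤c+c ⟩
      c + c        ∎)
    where
    open ℕₚ.≤-Reasoning
    c t : ℕ
    c = ⌈ m /2⌉
    t = m ∸ suc (suc c)
    m≡ : suc (suc c) + t ≡ m
    m≡ = ℕₚ.m+[n∸m]≡n (subst (_≤ m) (trans (sym (ℕₚ.+-suc c 1)) (ℕₚ.+-comm c 2)) κ<m)
    m≤c+c : m ≤ c + c
    m≤c+c = subst (_≤ c + c) (ℕₚ.⌊n/2⌋+⌈n/2⌉≡n m) (ℕₚ.+-monoˡ-≤ c (ℕₚ.⌊n/2⌋≤⌈n/2⌉ m))

  module SameBox (m D₁ D₂ n n' : ℕ) (a e : Fin 2 → ℕ)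
    (J∋n  : ∀ j → inTor b m (⌈ m /2⌉ + 1) (a j) (e j) (+ shiftedNet2 b m (idMat m) (lpMat m) D₁ D₂ n j))
    (J∋n' : ∀ j → inTor b m (⌈ m /2⌉ + 1) (a j) (e j) (+ shiftedNet2 b m (idMat m) (lpMat m) D₁ D₂ n' j))
    where

    private
      c : ℕ
      c = ⌈ m /2⌉
      digitsOf : ℕ → ℕ → ℕ
      digitsOf n l = digit b l n

    v : ℕ → ℤ
    v k = + truncate m (digitsOf n) k - + truncate m (digitsOf n') k

    T : ℕ → ℤ
    T j = + partialSum (digitsOf n) j - + partialSum (digitsOf n') j

    T-suc : ∀ j → j < m → T (suc j) ≡ T j ℤ.+ v j
    T-suc j j<m = begin
      + partialSum dn (suc j) - + partialSum dn' (suc j)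
        ≡⟨ cong₂ (λ s s' → + s - + s') (Σfin-snoc j dn) (Σfin-snoc j dn') ⟩
      + (partialSum dn j + dn j) - + (partialSum dn' j + dn' j)
        ≡⟨ cong₂ _-_ (ℤₚ.pos-+ (partialSum dn j) (dn j)) (ℤₚ.pos-+ (partialSum dn' j) (dn' j)) ⟩
      (+ partialSum dn j ℤ.+ + dn j) - (+ partialSum dn' j ℤ.+ + dn' j)
        ≡⟨ regroup (+ partialSum dn j) (+ partialSum dn' j) (+ dn j) (+ dn' j) ⟩
      T j ℤ.+ (+ dn j - + dn' j)
        ≡⟨ cong₂ (λ d d' → T j ℤ.+ (+ d - + d')) (truncate-< dn j<m) (truncate-< dn' j<m) ⟨
      T j ℤ.+ v j ∎
      where
      open ≡-Reasoning
      dn dn' : ℕ → ℕ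
      dn = digitsOf n
      dn' = digitsOf n'
      regroup : ∀ s s' d d' → (s ℤ.+ d) - (s' ℤ.+ d') ≡ (s - s') ℤ.+ (d - d')
      regroup = solve-∀

    v-shape : CarryShaped (c + 1) v
    v-shape = carryShaped-respects-mod
      (λ k _ → netDigits-difference m identity D₁ k (rowSum≡digit n k) (rowSum≡digit n' k))
      (sameInterval⇒netCarryShaped {m} {c + 1} {a first} {e first} identity D₁ n n'
         (J∋n first) (J∋n' first))
      where
      first : Fin 2
      first = Fin.zero
      rowSum≡digit : ∀ n k → truncate m (rowSum m identity n) k ≡ truncate m (digitsOf n) k
      rowSum≡digit n k with k <? m
      ... | yes k<m = Σfin-identity m (digitsOf n) k<m
      ... | no  _   = refl

    T-shape : c + 1 < m → CarryShaped (c + 1) (λ k → T (m ∸ k))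
    T-shape κ<m = carryShaped-respects-mod
      (λ k k≤κ → let k<m = ℕₚ.≤-<-trans k≤κ κ<m in
         netDigits-difference m F₂ D₂ k (rowSum≡partialSum n k<m) (rowSum≡partialSum n' k<m))
      (sameInterval⇒netCarryShaped {m} {c + 1} {a second} {e second} F₂ D₂ n n'
         (J∋n second) (J∋n' second))
      where
      F₂ : ℕ → ℕ → ℕ
      F₂ = larcherPillichshammer m
      second : Fin 2
      second = Fin.suc Fin.zero
      rowSum≡partialSum : ∀ n {k} → k < m → truncate m (rowSum m F₂ n) k ≡ partialSum (digitsOf n) (m ∸ k)
      rowSum≡partialSum n k<m =
        trans (truncate-< _ k<m) (Σfin-larcherPillichshammer m _ (digitsOf n) (ℕₚ.<⇒≤ k<m))

    v-divisible : ∀ l → l < m → + b ∣ v l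
    v-divisible l l<m with m ≤? c + 1
    ... | yes m≤κ = divisible-downward v-shape m≤κ b∣v[m] (ℕₚ.<⇒≤ l<m)
      where
      b∣v[m] : + b ∣ v m
      b∣v[m] = subst (+ b ∣_)
        (sym (cong₂ (λ d d' → + d - + d') (truncate-≥ {m} (digitsOf n) ℕₚ.≤-refl)
                                          (truncate-≥ {m} (digitsOf n') ℕₚ.≤-refl)))
        b∣0
    ... | no  m≰κ = partialSums⇒divisible {v = v} {T} m≡ 2+t≤c refl T-suc
                      (subst (λ κ → CarryShaped κ v) κ≡ v-shape)
                      (subst (λ κ → CarryShaped κ (λ k → T (m ∸ k))) κ≡ (T-shape κ<m)) l l<m
      where
      κ<m : c + 1 < m
      κ<m = ℕₚ.≰⇒> m≰κ
      κ≡ : c + 1 ≡ suc c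
      κ≡ = ℕₚ.+-comm c 1
      t : ℕ
      t = m ∸ suc (suc c)
      m≡ : suc (suc c) + t ≡ m
      m≡ = proj₁ (⌈m/2⌉-split m κ<m)
      2+t≤c : 2 + t ≤ c
      2+t≤c = proj₂ (⌈m/2⌉-split m κ<m)

    sameDigits : ∀ l → l < m → digit b l n ≡ digit b l n'
    sameDigits l l<m = digit-≡ (digit<b l n) (digit<b l n')
      (subst (+ b ∣_)
        (cong₂ (λ d d' → + d - + d') (truncate-< (digitsOf n) l<m) (truncate-< (digitsOf n') l<m))
        (v-divisible l l<m))
      where
      digit<b : ∀ l n → digit b l n < b
      digit<b l n = m%n<n (_/_ n (b ^ l) {{ℕₚ.m^n≢0 b l}}) b

    samePoint : ∀ j → shiftedNet2 b m (idMat m) (lpMat m) D₁ D₂ n j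
                    ≡ shiftedNet2 b m (idMat m) (lpMat m) D₁ D₂ n' j
    samePoint Fin.zero           = shiftedNum-cong (idMat m) D₁ sameDigits
    samePoint (Fin.suc Fin.zero) = shiftedNum-cong (lpMat m) D₂ sameDigits

mainTheorem6 : (b m : ℕ) → Prime b → 1 ≤ m → (D₁ D₂ : ℕ) → D₁ < b ^ m → D₂ < b ^ m →
    Separated b m 2 (b ^ m) (shiftedNet2 b m (idMat m) (lpMat m) D₁ D₂) (⌈ m /2⌉ + 1)
    × TorSeparated b m 2 (b ^ m) (shiftedNet2 b m (idMat m) (lpMat m) D₁ D₂) (⌈ m /2⌉ + 1)
mainTheorem6 0 _ b-prime = ⊥-elim (¬prime[0] b-prime)
mainTheorem6 1 _ b-prime = ⊥-elim (¬prime[1] b-prime)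
mainTheorem6 b@(suc (suc b-2)) m _ _ D₁ D₂ _ _ =
    ((λ _ → κ) , (λ _ → ℕₚ.≤-refl) , λ a e _ _ _ n n' _ _ J∋n J∋n' →
      SameBox.samePoint m D₁ D₂ n n' a e (toroidal a e J∋n) (toroidal a e J∋n'))
  , ((λ _ → κ) , (λ _ → ℕₚ.≤-refl) , λ a e _ _ n n' _ _ → SameBox.samePoint m D₁ D₂ n n' a e)
  where
  open InBase b-2 hiding (b)
  κ : ℕ
  κ = ⌈ m /2⌉ + 1
  point : ℕ → Fin 2 → ℕ
  point = shiftedNet2 b m (idMat m) (lpMat m) D₁ D₂
  toroidal : ∀ {n} (a e : Fin 2 → ℕ) → (∀ j → inInt b m κ (a j) (e j) (+ point n j)) →
             ∀ j → inTor b m κ (a j) (e j) (+ point n j)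
  toroidal {n} a e J∋n j = inInt⇒inTor b m κ (a j) (e j) (+ point n j) (J∋n j)
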